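{- The worst-case running time of Zielonka's recursive algorithm on (nested) solitaire parity games, as a function of the number of vertices $|V|$, is $\Omega(2^{|V|/3})$.
   Context: A parity game $G=(V,E,\mathcal{P},(V_\Diamond,V_\Box))$ consists of a finite vertex set $V$ partitioned into $V_\Diamond$ (owned by player even, $\Diamond$) and $V_\Box$ (owned by player odd, $\Box$), a total edge relation $E\subseteq V\times V$ (write $v\to w$) and a priority function $\mathcal{P}:V\to\mathbb{N}$. Player $\Diamond$ wins an infinite play iff the highest priority occurring infinitely often is even; a vertex is won by player $i$ if $i$ has a strategy winning every consistent play from it; solving means computing the winning regions $(W_\Diamond,W_\Box)$. For $A\subseteq V$, $G\setminus A$ is the game restricted to $V\setminus A$. $\overline{i}$ is the opponent of $i$. The $i$-attractor $\mathit{Attr}_i(U)$ of $U\subseteq V$ is the least superset of $U$ closed under adding vertices of $V_i$ having some successor in the set and vertices of $V_{\overline i}$ all of whose successors are in the set. Zielonka's algorithm $\textsc{Zielonka}(G)$: if $V=\emptyset$ return $(\emptyset,\emptyset)$. Otherwise let $m$ be the maximal priority, $p=\Diamond$ if $m$ even else $p=\Box$, $U=\{v\mid\mathcal{P}(v)=m\}$, $A=\mathit{Attr}_p(U)$, $(W'_\Diamond,W'_\Box)=\textsc{Zielonka}(G\setminus A)$. If $W'_{\overline p}=\emptyset$, return $W_p=A\cup W'_p$, $W_{\overline p}=\emptyset$. Otherwise let $B=\mathit{Attr}_{\overline p}(W'_{\overline p})$, $(W''_\Diamond,W''_\Box)=\textsc{Zielonka}(G\setminus B)$, and return $W_p=W''_p$,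 $W_{\overline p}=W''_{\overline p}\cup B$. A parity game is solitaire if all non-trivial moves (vertices with more than one successor) belong to a single player; it is nested solitaire if the subgame induced by each strongly connected component is a solitaire game. -}

module Defs where

open import Data.Nat using (ℕ; zero; suc; _+_; _⊔_; _≡ᵇ_)
open import Data.Bool using (Bool; true; false; _∧_; _∨_; not; if_then_else_)
open import Data.Fin using (Fin)
open import Data.List using (List; foldr; allFin)
open import Data.Bool.ListAction using (any; all)
open import Data.Product using (_×_; _,_; ∃; proj₁; proj₂)
open import Relation.Binary.PropositionalEquality using (_≡_; _≢_)
open import Relation.Binary.Construct.Closure.ReflexiveTransitive using (Star)

data Player : Set where
  Even Odd : Player

opp : Player → Player
opp Even = Odd
opp Odd  = Even

_==ᴾ_ : Player → Player → Bool
Even ==ᴾ Even = true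
Odd  ==ᴾ Odd  = true
_    ==ᴾ _    = false

parityOf : ℕ → Player
parityOf zero          = Even
parityOf (suc zero)    = Odd
parityOf (suc (suc m)) = parityOf m

record Game (n : ℕ) : Set where
  field
    owner : Fin n → Player
    edge  : Fin n → Fin n → Bool
    prio  : Fin n → ℕ
    total : ∀ v → ∃ λ w → edge v w ≡ true
open Game public

Edge : ∀ {n} → Game n → Fin n → Fin n → Set
Edge G v w = edge G v w ≡ true

VSet : ℕ → Set
VSet n = Fin n → Bool

∅ˢ : ∀ {n} → VSet n
∅ˢ _ = false

_∪ˢ_ : ∀ {n} → VSet n → VSet n → VSet n
(A ∪ˢ B) v = A v ∨ B v

_∖ˢ_ : ∀ {n} → VSet n → VSet n → VSet n
(A ∖ˢ B) v = A v ∧ not (B v)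

isEmpty : ∀ {n} → VSet n → Bool
isEmpty {n} S = not (any S (allFin n))

maxPrio : ∀ {n} → Game n → VSet n → ℕ
maxPrio {n} G S = foldr (λ v m → if S v then prio G v ⊔ m else m) 0 (allFin n)

attrStep : ∀ {n} → Game n → Player → VSet n → VSet n → VSet n
attrStep {n} G i S A v =
  A v ∨ (S v ∧ (if owner G v ==ᴾ i
                then any (λ w → S w ∧ edge G v w ∧ A w) (allFin n)
                else all (λ w → not (S w ∧ edge G v w) ∨ A w) (allFin n)))

iterAttr : ∀ {n} → ℕ → Game n → Player → VSet n → VSet n → VSet n
iterAttr zero    G i S A = A
iterAttr (suc k) G i S A = iterAttr k G i S (attrStep G i S A)

-- Attr_i(U) in the subgame induced by S (n iterations suffice to reach the fixpoint)
Attr : ∀ {n} → Game n → Player → VSet n → VSet n → VSet n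
Attr {n} G i S U = iterAttr n G i S (λ v → S v ∧ U v)

Regions : ℕ → Set
Regions n = VSet n × VSet n

win : ∀ {n} → Player → Regions n → VSet n
win Even W = proj₁ W
win Odd  W = proj₂ W

mkRegions : ∀ {n} → Player → VSet n → VSet n → Regions n
mkRegions Even Wp Wq = Wp , Wq
mkRegions Odd  Wp Wq = Wq , Wp

-- The ℕ argument is fuel; each recursive call is on a strictly smaller vertex set,
-- so with initial fuel n (= |V|) the fuel-exhausted case is only reached on the
-- empty subgame, where it agrees with the algorithm.
zielonka : ∀ {n} → Game n → ℕ → VSet n → Regions n × ℕ
zielonka G zero S = (∅ˢ , ∅ˢ) , 1
zielonka G (suc k) S with isEmpty S
... | true  = (∅ˢ , ∅ˢ) , 1
... | false =
  let m   = maxPrio G S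
      p   = parityOf m
      U   = λ v → S v ∧ (prio G v ≡ᵇ m)
      A   = Attr G p S U
      r1  = zielonka G k (S ∖ˢ A)
      W'  = proj₁ r1
      c1  = proj₂ r1
  in if isEmpty (win (opp p) W')
     then (mkRegions p (A ∪ˢ win p W') ∅ˢ , suc c1)
     else (let B   = Attr G (opp p) S (win (opp p) W')
               r2  = zielonka G k (S ∖ˢ B)
               W'' = proj₁ r2
           in mkRegions p (win p W'') (win (opp p) W'' ∪ˢ B) , suc (c1 + proj₂ r2))

calls : ∀ {n} → Game n → ℕ
calls {n} G = proj₂ (zielonka G n (λ _ → true))

NonTrivial : ∀ {n} → Game n → Fin n → Set
NonTrivial G v = ∃ λ w → ∃ λ w' → w ≢ w' × Edge G v w × Edge G v w'

Solitaire : ∀ {n} → Game n → Set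
Solitaire {n} G = ∃ λ (i : Player) → ∀ (v : Fin n) → NonTrivial G v → owner G v ≡ i

Reach : ∀ {n} → Game n → Fin n → Fin n → Set
Reach G = Star (Edge G)

SameSCC : ∀ {n} → Game n → Fin n → Fin n → Set
SameSCC G u v = Reach G u v × Reach G v u

-- the subgame induced by each SCC is solitaire: within the SCC of each vertex c,
-- all vertices with more than one successor inside that SCC belong to one player
NestedSolitaire : ∀ {n} → Game n → Set
NestedSolitaire {n} G =
  ∀ (c : Fin n) → ∃ λ (i : Player) → ∀ (v : Fin n) → SameSCC G c v →
    (∃ λ w → ∃ λ w' → w ≢ w' × SameSCC G c w × SameSCC G c w' × Edge G v w × Edge G v w') →
    owner G v ≡ i

-- Layer l of the game (vertices 3l, 3l+1, 3l+2) is a copy of the gadget a → {a, c}, c → b, b → b with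
-- priorities 4l, 4l+2, 4l+1 for a, c, b; only a, which belongs to Odd, has a choice. On the first j+1
-- layers Zielonka removes c, the top priority, and recurses on the first j layers plus {a, b}. There b
-- is on top, and removing it leaves the first j layers plus a, on which Even wins a; hence a second
-- recursive call follows, on the first j layers plus b. Both calls solve the first j layers in full,
-- so the number of calls doubles with each layer: at least 2^⌊n/3⌋ of them on n vertices.
module Submission where

open import Defs
open import Data.Nat
  using (ℕ; zero; suc; _+_; _*_; _^_; _/_; _%_; _⊔_; _≡ᵇ_; _<ᵇ_; _≤_; _<_; z≤n; s≤s)
open import Data.Nat.DivMod using (m≡m%n+[m/n]*n; m%n<n)
open import Data.Nat.Properties
  using ( ≤-refl; ≤-reflexive; ≤-trans; ≤-antisym; ≤-<-trans; <-≤-trans; <⇒≤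
        ; n≤1+n; m<1+n⇒m≤n
        ; m≤m+n; m≤n+m; +-comm; +-identityʳ; *-identityˡ; +-monoʳ-≤; +-monoʳ-<; +-mono-≤
        ; m≤m⊔n; m≤n⊔m; ⊔-lub; ≡ᵇ⇒≡; ≡⇒≡ᵇ; <⇒<ᵇ )
open import Data.Bool using (Bool; true; false; T; _∧_; _∨_; not; if_then_else_)
open import Data.Bool.Properties using (T-≡; T-∧)
open import Data.Empty using (⊥-elim)
open import Relation.Nullary using (¬_)
open import Data.Fin using (Fin; toℕ; fromℕ<)
open import Data.Fin.Properties using (toℕ-fromℕ<; toℕ<n; toℕ-injective)
open import Data.List using (List; []; _∷_; foldr; allFin)
open import Data.List.Membership.Propositional using (_∈_; lose)
open import Data.List.Membership.Propositional.Properties using (∈-allFin)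
open import Data.List.Relation.Unary.Any using (here; there; satisfied)
open import Data.List.Relation.Unary.Any.Properties using (any⁺; any⁻)
import Data.List.Relation.Unary.All as All
open import Data.List.Relation.Unary.All.Properties using (all⁺; all⁻)
open import Data.Bool.ListAction using (any; all)
open import Data.Product using (_×_; _,_; ∃; ∃₂; proj₁; proj₂)
open import Function using (_⇔_; mk⇔; Equivalence; _$_)
open Equivalence using (to; from)
import Function.Properties.Equivalence as ⇔
open import Relation.Binary.PropositionalEquality
  using (_≡_; refl; sym; trans; cong; cong₂; subst; subst₂; module ≡-Reasoning)

T-⇔→≡ : ∀ {x y} → T x ⇔ T y → x ≡ y
T-⇔→≡ {false} {false} _ = refl
T-⇔→≡ {false} {true}  h = ⊥-elim (from h _)
T-⇔→≡ {true}  {false} h = ⊥-elim (to h _)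
T-⇔→≡ {true}  {true}  _ = refl

split₃ : ∀ {x y z} → T (x ∧ y ∧ z) → T x × T y × T z
split₃ {x} h = let tx , tyz = to (T-∧ {x}) h in tx , to T-∧ tyz

join₃ : ∀ {x y z} → T x → T y → T z → T (x ∧ y ∧ z)
join₃ tx ty tz = from T-∧ (tx , from T-∧ (ty , tz))

T-⇒ : ∀ {x y z} → T (not (x ∧ y) ∨ z) ⇔ (T x → T y → T z)
T-⇒ {true}  {true}  = mk⇔ (λ h _ _ → h) (λ h → h _ _)
T-⇒ {true}  {false} = mk⇔ (λ _ _ ()) (λ _ → _)
T-⇒ {false}         = mk⇔ (λ _ ()) (λ _ → _)

module _ {A : Set} {xs : List A} (complete : ∀ x → x ∈ xs) (f : A → Bool) where

  any-complete : T (any f xs) ⇔ ∃ λ x → T (f x)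
  any-complete = mk⇔ (λ h → satisfied (any⁻ f xs h)) (λ (x , fx) → any⁺ f (lose (complete x) fx))

  all-complete : T (all f xs) ⇔ (∀ x → T (f x))
  all-complete = mk⇔ (λ h x → All.lookup (all⁺ f xs h) (complete x))
                     (λ h → all⁻ f {xs} (All.tabulate λ {x} _ → h x))

module _ {n : ℕ} where

  infix 4 _≗_ _≋_

  _≗_ : VSet n → VSet n → Set
  S ≗ S' = ∀ v → S v ≡ S' v

  _≋_ : Regions n → Regions n → Set
  W ≋ W' = proj₁ W ≗ proj₁ W' × proj₂ W ≗ proj₂ W'

  isEmpty-false : ∀ {S : VSet n} v → T (S v) → isEmpty S ≡ false
  isEmpty-false {S} v v∈S =
    cong not (to T-≡ (from (any-complete ∈-allFin S) (v , v∈S)))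

  isEmpty-true : ∀ {S : VSet n} → S ≗ ∅ˢ → isEmpty S ≡ true
  isEmpty-true {S} S≗∅ = cong not (T-⇔→≡ (mk⇔ nothing-in-S λ ()))
    where
    nothing-in-S : T (any S (allFin n)) → T false
    nothing-in-S h = let v , v∈S = to (any-complete ∈-allFin S) h in subst T (S≗∅ v) v∈S

module Unfolding {n} (G : Game n) (k : ℕ) (S : VSet n) (m : ℕ) (p : Player)
    (nonempty : isEmpty S ≡ false) (max : maxPrio G S ≡ m) (parity : parityOf m ≡ p) where

  A : VSet n
  A = Attr G p S (λ v → S v ∧ (prio G v ≡ᵇ m))

  first : Regions n × ℕ
  first = zielonka G k (S ∖ˢ A)

  zielonka-then : isEmpty (win (opp p) (proj₁ first)) ≡ true →
    zielonka G (suc k) S ≡ (mkRegions p (A ∪ˢ win p (proj₁ first)) ∅ˢ , suc (proj₂ first))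
  zielonka-then empty rewrite nonempty | max | parity | empty = refl

  B : VSet n
  B = Attr G (opp p) S (win (opp p) (proj₁ first))

  second : Regions n × ℕ
  second = zielonka G k (S ∖ˢ B)

  zielonka-else : isEmpty (win (opp p) (proj₁ first)) ≡ false →
    zielonka G (suc k) S ≡
      ( mkRegions p (win p (proj₁ second)) (win (opp p) (proj₁ second) ∪ˢ B)
      , suc (proj₂ first + proj₂ second) )
  zielonka-else nonempty′ rewrite nonempty | max | parity | nonempty′ = refl

zielonka-∅ : ∀ {n} (G : Game n) k {S : VSet n} → S ≗ ∅ˢ → zielonka G k S ≡ ((∅ˢ , ∅ˢ) , 1)
zielonka-∅ G zero    S≗∅ = refl
zielonka-∅ G (suc k) S≗∅ rewrite isEmpty-true S≗∅ = refl

module _ {n} (G : Game n) (S : VSet n) where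

  private
    maxOf : List (Fin n) → ℕ
    maxOf = foldr (λ v m → if S v then prio G v ⊔ m else m) 0

    maxOf-≤ : ∀ {m} → (∀ v → T (S v) → prio G v ≤ m) → ∀ xs → maxOf xs ≤ m
    maxOf-≤ bound []       = z≤n
    maxOf-≤ bound (x ∷ xs) with S x in x∈S
    ... | true  = ⊔-lub (bound x (from T-≡ x∈S)) (maxOf-≤ bound xs)
    ... | false = maxOf-≤ bound xs

    maxOf-≥ : ∀ {v} → T (S v) → ∀ {xs} → v ∈ xs → prio G v ≤ maxOf xs
    maxOf-≥ v∈S {x ∷ xs} v∈xs with S x in x∈S | v∈xs
    ... | true  | here refl  = m≤m⊔n _ _
    ... | true  | there v∈xs = ≤-trans (maxOf-≥ v∈S v∈xs) (m≤n⊔m _ _)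
    ... | false | here refl  = ⊥-elim (subst T x∈S v∈S)
    ... | false | there v∈xs = maxOf-≥ v∈S v∈xs

  maxPrio-attained : ∀ {m} v → (∀ w → T (S w) → prio G w ≤ m) → T (S v) → prio G v ≡ m →
    maxPrio G S ≡ m
  maxPrio-attained v bound v∈S refl =
    ≤-antisym (maxOf-≤ bound (allFin n)) (maxOf-≥ v∈S (∈-allFin v))

solitaire⇒nested : ∀ {n} {G : Game n} → Solitaire G → NestedSolitaire G
solitaire⇒nested (i , owned) _ =
  i , λ v _ (w , w′ , w≢w′ , _ , _ , e , e′) → owned v (w , w′ , w≢w′ , e , e′)

-- One layer: roles, masks and the local attractor

data Role : Set where
  a b c : Role

rnum : Role → ℕ
rnum a = 0
rnum b = 1
rnum c = 2

roles : List Role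
roles = a ∷ b ∷ c ∷ []

∈-roles : ∀ r → r ∈ roles
∈-roles a = here refl
∈-roles b = there (here refl)
∈-roles c = there (there (here refl))

layer : ℕ → ℕ
layer (suc (suc (suc k))) = suc (layer k)
layer _                   = 0

role : ℕ → Role
role 0                   = a
role 1                   = b
role 2                   = c
role (suc (suc (suc k))) = role k

layer-role : ∀ k → layer k * 3 + rnum (role k) ≡ k
layer-role 0                   = refl
layer-role 1                   = refl
layer-role 2                   = refl
layer-role (suc (suc (suc k))) = cong (λ m → suc (suc (suc m))) (layer-role k)

layer-encode : ∀ l r → layer (l * 3 + rnum r) ≡ l
layer-encode zero    a = refl
layer-encode zero    b = refl
layer-encode zero    c = refl
layer-encode (suc l) r = cong suc (layer-encode l r)

role-encode : ∀ l r → role (l * 3 + rnum r) ≡ r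
role-encode zero    a = refl
role-encode zero    b = refl
role-encode zero    c = refl
role-encode (suc l) r = role-encode l r

data Mask : Set where
  ⟨_,_,_⟩ : Bool → Bool → Bool → Mask

infix 7 _∋_

_∋_ : Mask → Role → Bool
⟨ x , _ , _ ⟩ ∋ a = x
⟨ _ , y , _ ⟩ ∋ b = y
⟨ _ , _ , z ⟩ ∋ c = z

tabulate : (Role → Bool) → Mask
tabulate f = ⟨ f a , f b , f c ⟩

∋-tabulate : ∀ f r → tabulate f ∋ r ≡ f r
∋-tabulate f a = refl
∋-tabulate f b = refl
∋-tabulate f c = refl

uniform : Bool → Mask
uniform x = ⟨ x , x , x ⟩

∋-uniform : ∀ x r → uniform x ∋ r ≡ x
∋-uniform x a = refl
∋-uniform x b = refl
∋-uniform x c = refl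

zipMask : (Bool → Bool → Bool) → Mask → Mask → Mask
zipMask f m m′ = tabulate λ r → f (m ∋ r) (m′ ∋ r)

∋-zipMask : ∀ f m m′ r → zipMask f m m′ ∋ r ≡ f (m ∋ r) (m′ ∋ r)
∋-zipMask f m m′ = ∋-tabulate λ r → f (m ∋ r) (m′ ∋ r)

single : Role → Mask
single t = tabulate λ r → rnum r ≡ᵇ rnum t

-- One more than the largest role present, so a layer-j shape occupies vertices below width + 3j.
width : Mask → ℕ
width ⟨ _     , _     , true ⟩ = 3
width ⟨ _     , true  , false ⟩ = 2
width ⟨ true  , false , false ⟩ = 1
width ⟨ false , false , false ⟩ = 0

∋⇒<width : ∀ m r → T (m ∋ r) → rnum r < width m
∋⇒<width ⟨ _ , _ , true ⟩ r _ = lt r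
  where lt : ∀ r → rnum r < 3
        lt a = s≤s z≤n
        lt b = s≤s (s≤s z≤n)
        lt c = s≤s (s≤s (s≤s z≤n))
∋⇒<width ⟨ _     , true  , false ⟩ a _ = s≤s z≤n
∋⇒<width ⟨ _     , true  , false ⟩ b _ = s≤s (s≤s z≤n)
∋⇒<width ⟨ true  , false , false ⟩ a _ = s≤s z≤n

width-∋ : ∀ m t → width m ≡ suc (rnum t) → T (m ∋ t)
width-∋ ⟨ _     , _     , true ⟩  c refl = _
width-∋ ⟨ _     , true  , false ⟩ b refl = _
width-∋ ⟨ true  , false , false ⟩ a refl = _

ownerOf : Role → Player
ownerOf a = Odd
ownerOf b = Even
ownerOf c = Even

infix 7 _↝_

_↝_ : Role → Role → Bool
a ↝ a = true
a ↝ c = true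
b ↝ b = true
c ↝ b = true
_ ↝ _ = false

sole-successor : ∀ r r′ → ownerOf r ≡ Even → T (r ↝ r′) → r′ ≡ b
sole-successor b b _ _ = refl
sole-successor c b _ _ = refl
sole-successor a _ () _
sole-successor b a _ ()
sole-successor b c _ ()
sole-successor c a _ ()
sole-successor c c _ ()

-- The superscript ᴸ marks the attractor computation of Defs carried out inside one layer, on masks.
attrStepAt : Player → Mask → Mask → Role → Bool
attrStepAt i s x r =
  x ∋ r ∨ (s ∋ r ∧ (if ownerOf r ==ᴾ i
                    then any (λ r′ → s ∋ r′ ∧ r ↝ r′ ∧ x ∋ r′) roles
                    else all (λ r′ → not (s ∋ r′ ∧ r ↝ r′) ∨ x ∋ r′) roles))

attrStepᴸ : Player → Mask → Mask → Mask
attrStepᴸ i s x = tabulate (attrStepAt i s x)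

iterAttrᴸ : ℕ → Player → Mask → Mask → Mask
iterAttrᴸ zero    i s x = x
iterAttrᴸ (suc k) i s x = iterAttrᴸ k i s (attrStepᴸ i s x)

iterAttrᴸ-fixed : ∀ {i s x} → attrStepᴸ i s x ≡ x → ∀ k → iterAttrᴸ k i s x ≡ x
iterAttrᴸ-fixed fixed zero    = refl
iterAttrᴸ-fixed fixed (suc k) rewrite fixed = iterAttrᴸ-fixed fixed k

iterAttrᴸ-settled : ∀ {i s x} → attrStepᴸ i s (iterAttrᴸ 2 i s x) ≡ iterAttrᴸ 2 i s x →
  ∀ {k} → 2 ≤ k → iterAttrᴸ k i s x ≡ iterAttrᴸ 2 i s x
iterAttrᴸ-settled fixed {suc (suc k)} _ = iterAttrᴸ-fixed fixed k
iterAttrᴸ-settled fixed {suc zero} (s≤s ())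

data Position : Set where
  under level over : Position

position : ℕ → ℕ → Position
position zero    zero    = level
position zero    (suc _) = under
position (suc _) zero    = over
position (suc l) (suc j) = position l j

position-refl : ∀ j → position j j ≡ level
position-refl zero    = refl
position-refl (suc j) = position-refl j

none : Mask
none = uniform false

-- At layer j, a shape stands for all vertices of the layers under j (if base holds) together with the
-- roles top of layer j itself.
record Shape : Set where
  constructor _▹_
  field
    base : Bool
    top  : Mask
open Shape

infix 4 _▹_
infixl 6 _∪ₛ_ _∩ₛ_ _∖ₛ_

maskAt : Shape → Position → Mask
maskAt σ under = uniform (base σ)
maskAt σ level = top σ
maskAt σ over  = none

zipShape : (Bool → Bool → Bool) → Shape → Shape → Shape
zipShape f σ τ = f (base σ) (base τ) ▹ zipMask f (top σ) (top τ)

maskAt-zip : ∀ f → f false false ≡ false → ∀ σ τ p r →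
  maskAt (zipShape f σ τ) p ∋ r ≡ f (maskAt σ p ∋ r) (maskAt τ p ∋ r)
maskAt-zip f ff σ τ under r
  rewrite ∋-uniform (f (base σ) (base τ)) r | ∋-uniform (base σ) r | ∋-uniform (base τ) r = refl
maskAt-zip f ff σ τ level r = ∋-zipMask f (top σ) (top τ) r
maskAt-zip f ff σ τ over  r rewrite ∋-uniform false r = sym ff

_∪ₛ_ _∩ₛ_ _∖ₛ_ : Shape → Shape → Shape
_∪ₛ_ = zipShape _∨_
_∩ₛ_ = zipShape _∧_
_∖ₛ_ = zipShape λ x y → x ∧ not y

∅ₛ : Shape
∅ₛ = false ▹ none

only : Role → Shape
only t = false ▹ single t

below below+a below+b below+ab below+abc : Shape
below     = true ▹ none
below+a   = true ▹ ⟨ true  , false , false ⟩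
below+b   = true ▹ ⟨ false , true  , false ⟩
below+ab  = true ▹ ⟨ true  , true  , false ⟩
below+abc = true ▹ uniform true

maskAt-below-zero : ∀ l → maskAt below (position l 0) ≡ none
maskAt-below-zero zero    = refl
maskAt-below-zero (suc l) = refl

maskAt-below-suc : ∀ l j → maskAt below (position l (suc j)) ≡ maskAt below+abc (position l j)
maskAt-below-suc zero          zero    = refl
maskAt-below-suc zero          (suc j) = refl
maskAt-below-suc (suc zero)    zero    = refl
maskAt-below-suc (suc (suc l)) zero    = refl
maskAt-below-suc (suc l)       (suc j) = maskAt-below-suc l j

winₛ : Player → Shape × Shape → Shape
winₛ Even = proj₁
winₛ Odd  = proj₂

mkRegionsₛ : Player → Shape → Shape → Shape × Shape
mkRegionsₛ Even σ τ = σ , τ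
mkRegionsₛ Odd  σ τ = τ , σ

attrShape : Player → Shape → Shape → Shape
attrShape i σ υ = base σ ∧ base υ ▹ iterAttrᴸ 2 i (top σ) (zipMask _∧_ (top σ) (top υ))

-- Inside one gadget an attractor is complete after two steps; on concrete shapes Stable holds by refl.
Stable : Player → Shape → Shape → Set
Stable i σ υ = attrStepᴸ i (top σ) (top (attrShape i σ υ)) ≡ top (attrShape i σ υ)

iterAttrᴸ-maskAt : ∀ i σ υ → Stable i σ υ → ∀ {k} → 2 ≤ k → ∀ p →
  iterAttrᴸ k i (maskAt σ p) (zipMask _∧_ (maskAt σ p) (maskAt υ p)) ≡ maskAt (attrShape i σ υ) p
iterAttrᴸ-maskAt i     (true  ▹ _) (true  ▹ _) _ {k} _ under = iterAttrᴸ-fixed refl k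
iterAttrᴸ-maskAt Even  (true  ▹ _) (false ▹ _) _ {k} _ under = iterAttrᴸ-fixed refl k
iterAttrᴸ-maskAt Odd   (true  ▹ _) (false ▹ _) _ {k} _ under = iterAttrᴸ-fixed refl k
iterAttrᴸ-maskAt i     (false ▹ _) _           _ {k} _ under = iterAttrᴸ-fixed refl k
iterAttrᴸ-maskAt i     σ           υ      stable     2≤k level = iterAttrᴸ-settled stable 2≤k
iterAttrᴸ-maskAt i     σ           υ           _ {k} _ over  = iterAttrᴸ-fixed refl k

maskAt<width : ∀ σ l j r → T (maskAt σ (position l j) ∋ r) → l * 3 + rnum r < j * 3 + width (top σ)
maskAt<width σ zero    zero    r h = ∋⇒<width (top σ) r h
maskAt<width σ zero    (suc j) a _ = s≤s z≤n
maskAt<width σ zero    (suc j) b _ = s≤s (s≤s z≤n)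
maskAt<width σ zero    (suc j) c _ = s≤s (s≤s (s≤s z≤n))
maskAt<width σ (suc l) zero    r h = ⊥-elim (subst T (∋-uniform false r) h)
maskAt<width σ (suc l) (suc j) r h = s≤s (s≤s (s≤s (maskAt<width σ l j r h)))

prio-≤ : ∀ σ t → width (top σ) ≡ suc (rnum t) →
  ∀ l j r → T (maskAt σ (position l j) ∋ r) → l * 4 + rnum r ≤ j * 4 + rnum t
prio-≤ σ t w≡ zero    zero    r h = m<1+n⇒m≤n (subst (rnum r <_) w≡ (∋⇒<width (top σ) r h))
prio-≤ σ t w≡ zero    (suc j) a _ = z≤n
prio-≤ σ t w≡ zero    (suc j) b _ = s≤s z≤n
prio-≤ σ t w≡ zero    (suc j) c _ = s≤s (s≤s z≤n)
prio-≤ σ t w≡ (suc l) zero    r h = ⊥-elim (subst T (∋-uniform false r) h)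
prio-≤ σ t w≡ (suc l) (suc j) r h = s≤s (s≤s (s≤s (s≤s (prio-≤ σ t w≡ l j r h))))

prio-≡ᵇ : ∀ l j r t → (l * 4 + rnum r ≡ᵇ j * 4 + rnum t) ≡ maskAt (only t) (position l j) ∋ r
prio-≡ᵇ zero    zero    r t = sym (∋-tabulate (λ r → rnum r ≡ᵇ rnum t) r)
prio-≡ᵇ zero    (suc j) a t = refl
prio-≡ᵇ zero    (suc j) b t = refl
prio-≡ᵇ zero    (suc j) c t = refl
prio-≡ᵇ (suc l) zero    r a = sym (∋-uniform false r)
prio-≡ᵇ (suc l) zero    r b = sym (∋-uniform false r)
prio-≡ᵇ (suc l) zero    r c = sym (∋-uniform false r)
prio-≡ᵇ (suc l) (suc j) r t = prio-≡ᵇ l j r t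

parityOf-*4+ : ∀ j m → parityOf (j * 4 + m) ≡ parityOf m
parityOf-*4+ zero    m = refl
parityOf-*4+ (suc j) m = parityOf-*4+ j m

prefix : ℕ → Mask
prefix w = tabulate λ r → rnum r <ᵇ w

maskAt-prefix : ∀ w → w ≤ 3 → ∀ l J r → l * 3 + rnum r < J * 3 + w →
  T (maskAt (true ▹ prefix w) (position l J) ∋ r)
maskAt-prefix w _   zero    zero    r lt = subst T (sym (∋-tabulate (λ r → rnum r <ᵇ w) r)) (<⇒<ᵇ lt)
maskAt-prefix w _   zero    (suc J) r _  = subst T (sym (∋-uniform true r)) _
maskAt-prefix w w≤3 (suc l) zero    r lt = ⊥-elim (four≰three (≤-trans lt w≤3))
  where four≰three : ∀ {x} → ¬ 4 + x ≤ 3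
        four≰three (s≤s (s≤s (s≤s ())))
maskAt-prefix w w≤3 (suc l) (suc J) r (s≤s (s≤s (s≤s lt))) = maskAt-prefix w w≤3 l J r lt

-- The layered game on n vertices

module LayeredGame (n : ℕ) where

  L : Fin n → ℕ
  L v = layer (toℕ v)

  R : Fin n → Role
  R v = role (toℕ v)

  vertex : ∀ l r → l * 3 + rnum r < n → Fin n
  vertex l r lt = fromℕ< lt

  L-vertex : ∀ l r lt → L (vertex l r lt) ≡ l
  L-vertex l r lt = trans (cong layer (toℕ-fromℕ< lt)) (layer-encode l r)

  R-vertex : ∀ l r lt → R (vertex l r lt) ≡ r
  R-vertex l r lt = trans (cong role (toℕ-fromℕ< lt)) (role-encode l r)

  vertex-unique : ∀ {v w} → L v ≡ L w → R v ≡ R w → v ≡ w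
  vertex-unique {v} {w} eqL eqR = toℕ-injective (begin
    toℕ v                   ≡⟨ sym (layer-role (toℕ v)) ⟩
    L v * 3 + rnum (R v)    ≡⟨ cong₂ (λ l r → l * 3 + rnum r) eqL eqR ⟩
    L w * 3 + rnum (R w)    ≡⟨ layer-role (toℕ w) ⟩
    toℕ w                   ∎)
    where open ≡-Reasoning

  edgeᴳ : Fin n → Fin n → Bool
  edgeᴳ v w = (L w ≡ᵇ L v) ∧ R v ↝ R w

  edge-intro : ∀ {v w} → L w ≡ L v → T (R v ↝ R w) → T (edgeᴳ v w)
  edge-intro {v} {w} same mv = from T-∧ (≡⇒≡ᵇ (L w) (L v) same , mv)

  edge-elim : ∀ {v w} → T (edgeᴳ v w) → L w ≡ L v × T (R v ↝ R w)
  edge-elim {v} {w} e = let same , mv = to T-∧ e in ≡ᵇ⇒≡ (L w) (L v) same , mv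

  has-successor : ∀ v r → R v ≡ r → ∃ λ w → T (edgeᴳ v w)
  has-successor v a eq = v , edge-intro {v} {v} refl (subst (λ r → T (r ↝ r)) (sym eq) _)
  has-successor v b eq = v , edge-intro {v} {v} refl (subst (λ r → T (r ↝ r)) (sym eq) _)
  has-successor v c eq =
    w , edge-intro {v} {w} (L-vertex (L v) b lt)
          (subst₂ (λ r r′ → T (r ↝ r′)) (sym eq) (sym (R-vertex (L v) b lt)) _)
    where
    v≡ : toℕ v ≡ L v * 3 + 2
    v≡ = trans (sym (layer-role (toℕ v))) (cong (λ r → L v * 3 + rnum r) eq)
    lt : L v * 3 + 1 < n
    lt = ≤-<-trans (+-monoʳ-≤ (L v * 3) (n≤1+n 1)) (subst (_< n) v≡ (toℕ<n v))
    w = vertex (L v) b lt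

  game : Game n
  game = record
    { owner = λ v → ownerOf (R v)
    ; edge  = edgeᴳ
    ; prio  = λ v → L v * 4 + rnum (R v)
    ; total = λ v → let w , e = has-successor v (R v) refl in w , to T-≡ e
    }

  ⟪_⟫ : (ℕ → Mask) → VSet n
  ⟪ μ ⟫ v = μ (L v) ∋ R v

  Fits : (ℕ → Mask) → Set
  Fits μ = ∀ l r → T (μ l ∋ r) → l * 3 + rnum r < n

  ⟪⟫-at : ∀ {Y} μ {w l r} → Y ≗ ⟪ μ ⟫ → L w ≡ l → R w ≡ r → Y w ≡ μ l ∋ r
  ⟪⟫-at μ {w} Y≗ refl refl = Y≗ w

  module _ (μ ξ : ℕ → Mask) {S X : VSet n} (fits : Fits μ) (S≗ : S ≗ ⟪ μ ⟫) (X≗ : X ≗ ⟪ ξ ⟫)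
           (v : Fin n) where

    someᴳ allᴳ : Fin n → Bool
    someᴳ w = S w ∧ edgeᴳ v w ∧ X w
    allᴳ  w = not (S w ∧ edgeᴳ v w) ∨ X w

    someᴸ allᴸ : Role → Bool
    someᴸ r = μ (L v) ∋ r ∧ R v ↝ r ∧ ξ (L v) ∋ r
    allᴸ  r = not (μ (L v) ∋ r ∧ R v ↝ r) ∨ ξ (L v) ∋ r

    private
      vertexIn : ∀ r → T (μ (L v) ∋ r) → ∃ λ w → L w ≡ L v × R w ≡ r
      vertexIn r r∈μ =
        let lt = fits (L v) r r∈μ in vertex (L v) r lt , L-vertex (L v) r lt , R-vertex (L v) r lt

      transport : ∀ {Y} ψ {w r} → Y ≗ ⟪ ψ ⟫ → L w ≡ L v → R w ≡ r → T (Y w) ⇔ T (ψ (L v) ∋ r)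
      transport ψ Y≗ eqL eqR = let eq = ⟪⟫-at ψ Y≗ eqL eqR in mk⇔ (subst T eq) (subst T (sym eq))

      edge-to : ∀ {w r} → L w ≡ L v → R w ≡ r → T (R v ↝ r) → T (edgeᴳ v w)
      edge-to {w} eqL refl = edge-intro {v} {w} eqL

      someᴳ⇒someᴸ : (∃ λ w → T (someᴳ w)) → ∃ λ r → T (someᴸ r)
      someᴳ⇒someᴸ (w , h) =
        let s , e , x = split₃ {S w} h ; same , mv = edge-elim {v} {w} e
        in R w , join₃ (to (transport μ S≗ same refl) s) mv (to (transport ξ X≗ same refl) x)

      someᴸ⇒someᴳ : (∃ λ r → T (someᴸ r)) → ∃ λ w → T (someᴳ w)
      someᴸ⇒someᴳ (r , h) =
        let s , mv , x = split₃ {μ (L v) ∋ r} h ; w , eqL , eqR = vertexIn r s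
        in w , join₃ (from (transport μ S≗ eqL eqR) s) (edge-to eqL eqR mv)
                     (from (transport ξ X≗ eqL eqR) x)

      allᴳ⇒allᴸ : (∀ w → T (allᴳ w)) → ∀ r → T (allᴸ r)
      allᴳ⇒allᴸ h r = from (T-⇒ {μ (L v) ∋ r}) λ s mv →
        let w , eqL , eqR = vertexIn r s
        in to (transport ξ X≗ eqL eqR)
              (to (T-⇒ {S w}) (h w) (from (transport μ S≗ eqL eqR) s) (edge-to eqL eqR mv))

      allᴸ⇒allᴳ : (∀ r → T (allᴸ r)) → ∀ w → T (allᴳ w)
      allᴸ⇒allᴳ h w = from (T-⇒ {S w}) λ s e →
        let same , mv = edge-elim {v} {w} e
        in from (transport ξ X≗ same refl)
                (to (T-⇒ {μ (L v) ∋ R w}) (h (R w)) (to (transport μ S≗ same refl) s) mv)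

    any-successors : any someᴳ (allFin n) ≡ any someᴸ roles
    any-successors = T-⇔→≡ $
      ⇔.trans (any-complete ∈-allFin someᴳ)
              (⇔.trans (mk⇔ someᴳ⇒someᴸ someᴸ⇒someᴳ) (⇔.sym (any-complete ∈-roles someᴸ)))

    all-successors : all allᴳ (allFin n) ≡ all allᴸ roles
    all-successors = T-⇔→≡ $
      ⇔.trans (all-complete ∈-allFin allᴳ)
              (⇔.trans (mk⇔ allᴳ⇒allᴸ allᴸ⇒allᴳ) (⇔.sym (all-complete ∈-roles allᴸ)))

  attrStep-⟪⟫ : ∀ i μ ξ {S X} → Fits μ → S ≗ ⟪ μ ⟫ → X ≗ ⟪ ξ ⟫ →
    attrStep game i S X ≗ ⟪ (λ l → attrStepᴸ i (μ l) (ξ l)) ⟫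
  attrStep-⟪⟫ i μ ξ fits S≗ X≗ v =
    trans (cong₂ _∨_ (X≗ v) (cong₂ _∧_ (S≗ v)
            (cong₂ (if ownerOf (R v) ==ᴾ i then_else_)
                   (any-successors μ ξ fits S≗ X≗ v) (all-successors μ ξ fits S≗ X≗ v))))
          (sym (∋-tabulate (attrStepAt i (μ (L v)) (ξ (L v))) (R v)))

  iterAttr-⟪⟫ : ∀ k i μ ξ {S X} → Fits μ → S ≗ ⟪ μ ⟫ → X ≗ ⟪ ξ ⟫ →
    iterAttr k game i S X ≗ ⟪ (λ l → iterAttrᴸ k i (μ l) (ξ l)) ⟫
  iterAttr-⟪⟫ zero    i μ ξ fits S≗ X≗ = X≗
  iterAttr-⟪⟫ (suc k) i μ ξ fits S≗ X≗ =
    iterAttr-⟪⟫ k i μ (λ l → attrStepᴸ i (μ l) (ξ l)) fits S≗ (attrStep-⟪⟫ i μ ξ fits S≗ X≗)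

  Attr-⟪⟫ : ∀ i μ ν {S U} → Fits μ → S ≗ ⟪ μ ⟫ → U ≗ ⟪ ν ⟫ →
    Attr game i S U ≗ ⟪ (λ l → iterAttrᴸ n i (μ l) (zipMask _∧_ (μ l) (ν l))) ⟫
  Attr-⟪⟫ i μ ν fits S≗ U≗ =
    iterAttr-⟪⟫ n i μ (λ l → zipMask _∧_ (μ l) (ν l)) fits S≗
      λ v → trans (cong₂ _∧_ (S≗ v) (U≗ v)) (sym (∋-zipMask _∧_ (μ (L v)) (ν (L v)) (R v)))

  layersOf : Shape → ℕ → ℕ → Mask
  layersOf σ j l = maskAt σ (position l j)

  ⟦_⟧ : Shape → ℕ → VSet n
  ⟦ σ ⟧ j = ⟪ layersOf σ j ⟫

  Fits-⟦⟧ : ∀ σ j → width (top σ) + j * 3 ≤ n → Fits (layersOf σ j)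
  Fits-⟦⟧ σ j size l r h =
    <-≤-trans (subst (l * 3 + rnum r <_) (+-comm (j * 3) _) (maskAt<width σ l j r h)) size

  zip-⟦⟧ : ∀ f → f false false ≡ false → ∀ {σ τ j X Y} → X ≗ ⟦ σ ⟧ j → Y ≗ ⟦ τ ⟧ j →
    (λ v → f (X v) (Y v)) ≗ ⟦ zipShape f σ τ ⟧ j
  zip-⟦⟧ f ff {σ} {τ} {j} X≗ Y≗ v =
    trans (cong₂ f (X≗ v) (Y≗ v)) (sym (maskAt-zip f ff σ τ (position (L v) j) (R v)))

  ⟦∅⟧ : ∀ j → ⟦ ∅ₛ ⟧ j ≗ ∅ˢ
  ⟦∅⟧ j v with position (L v) j
  ... | under = ∋-uniform false (R v)
  ... | level = ∋-uniform false (R v)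
  ... | over  = ∋-uniform false (R v)

  level-vertex : ∀ σ j r → width (top σ) + j * 3 ≤ n → T (top σ ∋ r) →
    ∃ λ v → L v ≡ j × R v ≡ r × T (⟦ σ ⟧ j v)
  level-vertex σ j r size r∈σ = v , L-vertex j r lt , R-vertex j r lt , subst T (sym v∈σ) r∈σ
    where
    lt = <-≤-trans (subst (j * 3 + rnum r <_) (+-comm (j * 3) _) (+-monoʳ-< (j * 3) (∋⇒<width (top σ) r r∈σ)))
                   size
    v = vertex j r lt
    v∈σ : ⟦ σ ⟧ j v ≡ top σ ∋ r
    v∈σ rewrite L-vertex j r lt | R-vertex j r lt | position-refl j = refl

  level-member : ∀ σ j r → width (top σ) + j * 3 ≤ n → T (top σ ∋ r) → ∃ λ v → T (⟦ σ ⟧ j v)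
  level-member σ j r size r∈σ = let v , _ , _ , v∈σ = level-vertex σ j r size r∈σ in v , v∈σ

  under-vertex : ∀ σ j → 0 < n → T (base σ) → ∃ λ v → T (⟦ σ ⟧ (suc j) v)
  under-vertex σ j 0<n b∈σ = v , subst T (sym v∈σ) b∈σ
    where
    v = vertex 0 a 0<n
    v∈σ : ⟦ σ ⟧ (suc j) v ≡ base σ
    v∈σ rewrite L-vertex 0 a 0<n | R-vertex 0 a 0<n = refl

  maxPrio-⟦⟧ : ∀ σ j t {S} → width (top σ) + j * 3 ≤ n → width (top σ) ≡ suc (rnum t) →
    S ≗ ⟦ σ ⟧ j → maxPrio game S ≡ j * 4 + rnum t
  maxPrio-⟦⟧ σ j t size w≡ S≗ =
    let v , eqL , eqR , v∈σ = level-vertex σ j t size (width-∋ (top σ) t w≡)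
    in maxPrio-attained game _ v (λ w w∈S → prio-≤ σ t w≡ (L w) j (R w) (subst T (S≗ w) w∈S))
         (subst T (sym (S≗ v)) v∈σ) (cong₂ (λ l r → l * 4 + rnum r) eqL eqR)

  seed-⟦⟧ : ∀ σ j t {S} → S ≗ ⟦ σ ⟧ j →
    (λ v → S v ∧ (prio game v ≡ᵇ j * 4 + rnum t)) ≗ ⟦ σ ∩ₛ only t ⟧ j
  seed-⟦⟧ σ j t S≗ = zip-⟦⟧ _∧_ refl S≗ λ v → prio-≡ᵇ (L v) j (R v) t

  Attr-⟦⟧ : ∀ i σ υ j {S U} → 2 ≤ n → width (top σ) + j * 3 ≤ n → Stable i σ υ →
    S ≗ ⟦ σ ⟧ j → U ≗ ⟦ υ ⟧ j → Attr game i S U ≗ ⟦ attrShape i σ υ ⟧ j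
  Attr-⟦⟧ i σ υ j 2≤n size stable S≗ U≗ v =
    trans (Attr-⟪⟫ i (layersOf σ j) (layersOf υ j) (Fits-⟦⟧ σ j size) S≗ U≗ v)
          (cong (_∋ R v) (iterAttrᴸ-maskAt i σ υ stable 2≤n (position (L v) j)))

  ⟦_⟧ᴿ : Shape × Shape → ℕ → Regions n
  ⟦ ε , ο ⟧ᴿ j = ⟦ ε ⟧ j , ⟦ ο ⟧ j

  win-≋ : ∀ p {W V j} → W ≋ ⟦ V ⟧ᴿ j → win p W ≗ ⟦ winₛ p V ⟧ j
  win-≋ Even = proj₁
  win-≋ Odd  = proj₂

  mkRegions-≋ : ∀ p {X Y σ τ j} → X ≗ ⟦ σ ⟧ j → Y ≗ ⟦ τ ⟧ j →
    mkRegions p X Y ≋ ⟦ mkRegionsₛ p σ τ ⟧ᴿ j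
  mkRegions-≋ Even X≗ Y≗ = X≗ , Y≗
  mkRegions-≋ Odd  X≗ Y≗ = Y≗ , X≗

  Outcome : Shape × Shape → ℕ → ℕ → Regions n × ℕ → Set
  Outcome W j m r = proj₁ r ≋ ⟦ W ⟧ᴿ j × m ≤ proj₂ r

  -- zielonka returns regions as functions, which can only be compared pointwise, so a run is
  -- specified for every representation S of the subgame.
  record Run (k : ℕ) (σ : Shape) (j : ℕ) (W : Shape × Shape) (m : ℕ) : Set where
    constructor mkRun
    field outcome : ∀ {S} → S ≗ ⟦ σ ⟧ j → Outcome W j m (zielonka game k S)
  open Run

  run-∅ : ∀ {k σ j} → ⟦ σ ⟧ j ≗ ∅ˢ → Run k σ j (∅ₛ , ∅ₛ) 1
  run-∅ {k} {σ} {j} σ≗∅ = mkRun λ S≗ →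
    subst (Outcome _ j 1) (sym (zielonka-∅ game k (λ v → trans (S≗ v) (σ≗∅ v))))
      (((λ v → sym (⟦∅⟧ j v)) , (λ v → sym (⟦∅⟧ j v))) , ≤-refl)

  ⟦below⟧-suc : ∀ j → ⟦ below ⟧ (suc j) ≗ ⟦ below+abc ⟧ j
  ⟦below⟧-suc j v = cong (_∋ R v) (maskAt-below-suc (L v) j)

  ⟦below⟧-zero : ⟦ below ⟧ 0 ≗ ∅ˢ
  ⟦below⟧-zero v = trans (cong (_∋ R v) (maskAt-below-zero (L v))) (∋-uniform false (R v))

  ⟦∅⟧≗⟦below⟧-zero : ⟦ ∅ₛ ⟧ 0 ≗ ⟦ below ⟧ 0
  ⟦∅⟧≗⟦below⟧-zero v = trans (⟦∅⟧ 0 v) (sym (⟦below⟧-zero v))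

  run-cast : ∀ {k σ σ′ j j′ W W′ m m′} → ⟦ σ′ ⟧ j′ ≗ ⟦ σ ⟧ j → ⟦ W ⟧ᴿ j ≋ ⟦ W′ ⟧ᴿ j′ →
    m′ ≤ m → Run k σ j W m → Run k σ′ j′ W′ m′
  run-cast σ≗ (ε≗ , ο≗) m′≤m run = mkRun λ S≗ →
    let (ε′≗ , ο′≗) , m≤ = outcome run (λ v → trans (S≗ v) (σ≗ v))
    in ((λ v → trans (ε′≗ v) (ε≗ v)) , (λ v → trans (ο′≗ v) (ο≗ v))) , ≤-trans m′≤m m≤

  ⟦prefix⟧ : ∀ J w → w ≤ 3 → n ≡ w + J * 3 → ⟦ true ▹ prefix w ⟧ J ≗ (λ _ → true)
  ⟦prefix⟧ J w w≤3 n≡ v = to T-≡ (maskAt-prefix w w≤3 (L v) J (R v) lt)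
    where
    lt : L v * 3 + rnum (R v) < J * 3 + w
    lt = subst₂ _<_ (sym (layer-role (toℕ v))) (trans n≡ (+-comm w (J * 3))) (toℕ<n v)

  run-≤ : ∀ {k σ j W m m′} → m′ ≤ m → Run k σ j W m → Run k σ j W m′
  run-≤ = run-cast (λ _ → refl) ((λ _ → refl) , (λ _ → refl))

  -- Attr iterates attrStep n times, and a gadget needs two of them.
  module Runs (2≤n : 2 ≤ n) where

    private
      module FirstCall {k σ j W m} t
          (size : width (top σ) + j * 3 ≤ n) (w≡ : width (top σ) ≡ suc (rnum t))
          (stable : Stable (parityOf (rnum t)) σ (σ ∩ₛ only t))
          (run : Run k (σ ∖ₛ attrShape (parityOf (rnum t)) σ (σ ∩ₛ only t)) j W m)
          {S} (S≗ : S ≗ ⟦ σ ⟧ j) where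

        private
          p : Player
          p = parityOf (rnum t)

        nonempty : isEmpty S ≡ false
        nonempty = let v , _ , _ , v∈σ = level-vertex σ j t size (width-∋ (top σ) t w≡)
                   in isEmpty-false v (subst T (sym (S≗ v)) v∈σ)

        open Unfolding game k S (j * 4 + rnum t) p nonempty
          (maxPrio-⟦⟧ σ j t size w≡ S≗) (parityOf-*4+ j (rnum t)) public

        A≗ : A ≗ ⟦ attrShape p σ (σ ∩ₛ only t) ⟧ j
        A≗ = Attr-⟦⟧ p σ (σ ∩ₛ only t) j 2≤n size stable S≗ (seed-⟦⟧ σ j t S≗)

        first-run : Outcome W j m first
        first-run = outcome run (zip-⟦⟧ (λ x y → x ∧ not y) refl S≗ A≗)

    run-then : ∀ {k σ j W m} t → let p = parityOf (rnum t) ; α = attrShape p σ (σ ∩ₛ only t) in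
      width (top σ) + j * 3 ≤ n → width (top σ) ≡ suc (rnum t) → Stable p σ (σ ∩ₛ only t) →
      Run k (σ ∖ₛ α) j W m → ⟦ winₛ (opp p) W ⟧ j ≗ ∅ˢ →
      Run (suc k) σ j (mkRegionsₛ p (α ∪ₛ winₛ p W) ∅ₛ) (suc m)
    run-then {k} {σ} {j} {W} {m} t size w≡ stable run empty = mkRun then-outcome
      where
      p : Player
      p = parityOf (rnum t)

      α : Shape
      α = attrShape p σ (σ ∩ₛ only t)

      then-outcome : ∀ {S} → S ≗ ⟦ σ ⟧ j →
        Outcome (mkRegionsₛ p (α ∪ₛ winₛ p W) ∅ₛ) j (suc m) (zielonka game (suc k) S)
      then-outcome S≗ =
        subst (Outcome _ j _) (sym (zielonka-then (isEmpty-true λ v → trans (W≗ v) (empty v)))) $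
          mkRegions-≋ p (zip-⟦⟧ _∨_ refl A≗ (win-≋ p (proj₁ first-run))) (λ v → sym (⟦∅⟧ j v)) ,
          s≤s (proj₂ first-run)
        where
        open FirstCall {k} t size w≡ stable run S≗
        W≗ = win-≋ (opp p) (proj₁ first-run)

    run-else : ∀ {k σ j W W′ m m′} t →
      let p = parityOf (rnum t) ; α = attrShape p σ (σ ∩ₛ only t)
          β = attrShape (opp p) σ (winₛ (opp p) W) in
      width (top σ) + j * 3 ≤ n → width (top σ) ≡ suc (rnum t) → Stable p σ (σ ∩ₛ only t) →
      Run k (σ ∖ₛ α) j W m → (∃ λ v → T (⟦ winₛ (opp p) W ⟧ j v)) →
      Stable (opp p) σ (winₛ (opp p) W) → Run k (σ ∖ₛ β) j W′ m′ →
      Run (suc k) σ j (mkRegionsₛ p (winₛ p W′) (winₛ (opp p) W′ ∪ₛ β)) (suc (m + m′))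
    run-else {k} {σ} {j} {W} {W′} {m} {m′} t size w≡ stable run (u , u∈W) stable′ run′ =
      mkRun else-outcome
      where
      p : Player
      p = parityOf (rnum t)

      β : Shape
      β = attrShape (opp p) σ (winₛ (opp p) W)

      else-outcome : ∀ {S} → S ≗ ⟦ σ ⟧ j →
        Outcome (mkRegionsₛ p (winₛ p W′) (winₛ (opp p) W′ ∪ₛ β)) j (suc (m + m′))
                (zielonka game (suc k) S)
      else-outcome S≗ =
        subst (Outcome _ j _) (sym (zielonka-else (isEmpty-false u (subst T (sym (W≗ u)) u∈W)))) $
          mkRegions-≋ p (win-≋ p (proj₁ second-run))
                        (zip-⟦⟧ _∨_ refl (win-≋ (opp p) (proj₁ second-run)) B≗) ,
          s≤s (+-mono-≤ (proj₂ first-run) (proj₂ second-run))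
        where
        open FirstCall {k} t size w≡ stable run S≗
        W≗ = win-≋ (opp p) (proj₁ first-run)
        B≗ : B ≗ ⟦ β ⟧ j
        B≗ = Attr-⟦⟧ (opp p) σ (winₛ (opp p) W) j 2≤n size stable′ S≗ W≗
        second-run = outcome run′ (zip-⟦⟧ (λ x y → x ∧ not y) refl S≗ B≗)

    run-only-a : ∀ j {k} → 1 + j * 3 ≤ n → Run (suc k) (only a) j (only a , ∅ₛ) 1
    run-only-a j size = run-≤ (n≤1+n 1) (run-then a size refl refl (run-∅ (⟦∅⟧ j)) (⟦∅⟧ j))

    -- The bounds on the fuel k keep zielonka from running out of it on a non-empty subgame.
    mutual
      run-below : ∀ j {k} → j * 3 ≤ k → j * 3 ≤ n → Run k below j (∅ₛ , below) (2 ^ j)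
      run-below zero    _ _ =
        run-cast (λ _ → refl) ((λ _ → refl) , ⟦∅⟧≗⟦below⟧-zero) ≤-refl (run-∅ ⟦below⟧-zero)
      run-below (suc j) (s≤s fuel) size =
        run-cast (⟦below⟧-suc j)
          ((λ v → trans (⟦∅⟧ j v) (sym (⟦∅⟧ (suc j) v))) , (λ v → sym (⟦below⟧-suc j v)))
          (≤-trans (m≤m+n _ 1) (n≤1+n _))
          (run-else c size refl refl (run-below+ab j fuel (<⇒≤ size))
            (level-member below+b j b (<⇒≤ size) _) refl (run-∅ (⟦∅⟧ j)))

      run-below+ab : ∀ j {k} → 2 + j * 3 ≤ k → 2 + j * 3 ≤ n →
        Run k below+ab j (only a , below+b) (2 ^ suc j)
      run-below+ab j (s≤s fuel) size =
        run-≤ (≤-trans (≤-reflexive (cong (2 ^ j +_) (+-identityʳ (2 ^ j)))) (n≤1+n _))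
          (run-else b size refl refl (run-below+a j fuel (<⇒≤ size))
            (level-member (only a) j a (<⇒≤ size) _) refl (run-below+b j fuel size))

      run-below+a : ∀ j {k} → 1 + j * 3 ≤ k → 1 + j * 3 ≤ n → Run k below+a j (only a , below) (2 ^ j)
      run-below+a zero (s≤s _) size =
        run-cast (λ _ → refl) ((λ _ → refl) , ⟦∅⟧≗⟦below⟧-zero) (n≤1+n 1)
          (run-then a size refl refl (run-below 0 z≤n z≤n) ⟦below⟧-zero)
      run-below+a (suc j) (s≤s fuel@(s≤s _)) size =
        run-≤ (≤-trans (m≤m+n _ 1) (n≤1+n _))
          (run-else a size refl refl (run-below (suc j) fuel (<⇒≤ size))
            (under-vertex below j (≤-trans (s≤s z≤n) size) _) refl (run-only-a (suc j) size))

      run-below+b : ∀ j {k} → 1 + j * 3 ≤ k → 2 + j * 3 ≤ n → Run k below+b j (∅ₛ , below+b) (2 ^ j)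
      run-below+b j (s≤s fuel) size =
        run-≤ (n≤1+n _) (run-then b size refl refl (run-below j fuel (≤-trans (m≤n+m _ 2) size)) (⟦∅⟧ j))

    run-prefix : ∀ J w → w < 3 → w + J * 3 ≤ n → ∃ λ W → Run n (true ▹ prefix w) J W (2 ^ J)
    run-prefix J 0 _ size = _ , run-below J size size
    run-prefix J 1 _ size = _ , run-below+a J size size
    run-prefix J 2 _ size = _ , run-≤ (m≤m+n _ _) (run-below+ab J size size)
    run-prefix J (suc (suc (suc _))) (s≤s (s≤s (s≤s ()))) _

  calls-bound : 2 ≤ n → 2 ^ (n / 3) ≤ calls game
  calls-bound 2≤n = proj₂ (outcome run λ v → sym (⟦prefix⟧ (n / 3) (n % 3) (<⇒≤ (m%n<n n 3)) n≡ v))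
    where
    n≡ = m≡m%n+[m/n]*n n 3
    run = proj₂ (Runs.run-prefix 2≤n (n / 3) (n % 3) (m%n<n n 3) (≤-reflexive (sym n≡)))

  successor-of-Even : ∀ {v w} → ownerOf (R v) ≡ Even → Edge game v w → L w ≡ L v × R w ≡ b
  successor-of-Even {v} {w} owned e =
    let same , mv = edge-elim {v} {w} (from T-≡ e) in same , sole-successor (R v) (R w) owned mv

  branching-owner : ∀ v → NonTrivial game v → ownerOf (R v) ≡ Odd
  branching-owner v (w , w′ , w≢w′ , e , e′) with ownerOf (R v) in owned
  ... | Odd  = refl
  ... | Even =
    let Lw , Rw = successor-of-Even owned e ; Lw′ , Rw′ = successor-of-Even owned e′
    in ⊥-elim (w≢w′ (vertex-unique (trans Lw (sym Lw′)) (trans Rw (sym Rw′))))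

  solitaire : Solitaire game
  solitaire = Odd , branching-owner

theorem3 : (∃₂ λ (c n₀ : ℕ) → ∀ (n : ℕ) → n₀ ≤ n → ∃ λ (G : Game n) → Solitaire G × 2 ^ (n / 3) ≤ c * calls G)
    × (∃₂ λ (c n₀ : ℕ) → ∀ (n : ℕ) → n₀ ≤ n → ∃ λ (G : Game n) → NestedSolitaire G × 2 ^ (n / 3) ≤ c * calls G)
theorem3 = (1 , 2 , λ n 2≤n → game n , solitaire n , bound n 2≤n)
         , (1 , 2 , λ n 2≤n → game n , solitaire⇒nested {G = game n} (solitaire n) , bound n 2≤n)
  where
  open LayeredGame using (game; solitaire)
  bound : ∀ n → 2 ≤ n → 2 ^ (n / 3) ≤ 1 * calls (game n)
  bound n 2≤n = subst (2 ^ (n / 3) ≤_) (sym (*-identityˡ _)) (LayeredGame.calls-bound n 2≤n)
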